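{- Let $H$ be a positive integer and $H_0>H_1>\dots>H_{r-1}$ positive integers with $H_0=H$, $H_{r-1}=1$ and $H_{k+1}$ dividing $H_k$ for all $k$. Let $R_1,\dots,R_n$ be rectangles, $R_i$ having positive integer width $\ell_i$ and height $h_i\in\{H_0,\dots,H_{r-1}\}$. If there exists a feasible height-divisible packing of these rectangles into a bin of width $\ell$ and height $H$, then there exists a feasible height-divisible packing of them into a bin of width $\ell$ and height $H$ that is in canonical form.
   Context: A packing assigns to each $R_i$ integer bottom-left coordinates $(x_i,y_i)$. It is feasible (for a bin of width $\ell$ and height $H$) if $x_i\ge0$, $y_i\ge 0$, $x_i+\ell_i\le \ell$, $y_i+h_i\le H$ for all $i$, and no two distinct rectangles overlap, where $R_i,R_j$ overlap if $x_i-\ell_j<x_j<x_i+\ell_i$ and $y_i-h_j<y_j<y_i+h_i$. It is height-divisible if $y_i$ is divisible by $h_i$ for every $i$. A height-divisible packing is in canonical form if for all $i,j\in\{1,\dots,n\}$: whenever $h_i>h_j$, $y_j\ge y_i$ and $y_j+h_j\le y_i+h_i$, we have $x_i+\ell_i\le x_j$. -}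

module Defs where

open import Data.Nat as ℕ using (ℕ; suc)
open import Data.Integer as ℤ using (ℤ; +_; _+_; _-_; _<_; _≤_)
open import Data.Integer.Divisibility using (_∣_)
open import Data.Fin using (Fin)
open import Data.Product using (_×_)
open import Relation.Binary.PropositionalEquality using (_≢_)
open import Relation.Nullary using (¬_)

-- An instance: n rectangles, rectangle i has width w i (= ℓ_i) and height h i.
-- A packing: integer bottom-left coordinates x i, y i.

Overlap : ∀ {n} (w h : Fin n → ℕ) (x y : Fin n → ℤ) → Fin n → Fin n → Set
Overlap w h x y i j =
  ((x i - + w j) < x j × x j < (x i + + w i)) ×
  ((y i - + h j) < y j × y j < (y i + + h i))

Feasible : ∀ {n} (L H : ℕ) (w h : Fin n → ℕ) (x y : Fin n → ℤ) → Set
Feasible L H w h x y =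
  (∀ i → (+ 0 ≤ x i) × (+ 0 ≤ y i) × (x i + + w i ≤ + L) × (y i + + h i ≤ + H)) ×
  (∀ i j → i ≢ j → ¬ Overlap w h x y i j)

HeightDivisible : ∀ {n} (h : Fin n → ℕ) (y : Fin n → ℤ) → Set
HeightDivisible h y = ∀ i → + h i ∣ y i

Canonical : ∀ {n} (w h : Fin n → ℕ) (x y : Fin n → ℤ) → Set
Canonical w h x y = ∀ i j →
  h i ℕ.> h j → y i ≤ y j → y j + + h j ≤ y i + + h i → x i + + w i ≤ x j

-- Keep every y-coordinate. Since of two heights the smaller divides the larger, and each
-- rectangle sits at a multiple of its height, two rectangles whose vertical extents meet are
-- nested: the shorter one lies within the extent of the taller. Now push rectangle i to the
-- x-coordinate equal to the total width of the rectangles preceding it: the taller ones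
-- covering its bottom row, and the ones of equal height at equal level with smaller index.
-- Precedence is transitive, so whatever precedes i ends strictly to its left, and any two
-- vertically overlapping rectangles are comparable, so the new packing is disjoint and
-- canonical. It fits in the bin because i and everything preceding it cover row y_i, hence
-- were pairwise disjoint in the original packing and have total width at most ℓ.
module Submission where

open import Data.Empty using (⊥-elim)
open import Data.Fin as Fin using (Fin; zero; suc; inject₁; fromℕ)
import Data.Fin.Properties as Fin
open import Data.Integer as ℤ using (ℤ; +_; +≤+; +<+; ∣_∣)
import Data.Integer.Properties as ℤ
open import Algebra.Properties.AbelianGroup ℤ.+-0-abelianGroup
  using (//-rightDividesˡ; //-rightDividesʳ)
open import Data.Nat
  using (ℕ; zero; suc; _+_; _∸_; _≤_; _<_; _>_; _≤?_; _<?_; _≟_; z≤n; s≤s; >-nonZero)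
open import Data.Nat.Divisibility
  using (_∣_; ∣-refl; ∣-trans; ∣-reflexive; ∣⇒≤; ∣m∣n⇒∣m+n; ∣m+n∣m⇒∣n)
open import Data.Nat.Properties
open import Algebra.Properties.CommutativeSemigroup +-commutativeSemigroup using (x∙yz≈y∙xz)
open import Data.Nat.Tactic.RingSolver using (solve-∀)
open import Data.Product using (_×_; _,_; ∃-syntax; proj₁; proj₂; swap; uncurry)
open import Data.Sum using (_⊎_; inj₁; inj₂)
open import Function using (_∘_)
open import Function.Bundles using (_⇔_; mk⇔; Equivalence)
open import Level using (Level)
open import Relation.Binary.Definitions using (tri<; tri≈; tri>)
open import Relation.Binary.PropositionalEquality
  using (_≡_; _≢_; _≗_; refl; sym; trans; cong; subst; subst₂)
open import Relation.Nullary using (Dec; yes; no; ¬_)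
open import Relation.Nullary.Decidable using (_×-dec_; _⊎-dec_)
open import Relation.Unary using (Pred; Decidable; _⊆_)
open import Relation.Unary.Properties using (_∩?_; ∁?)

open import Defs

private variable
  ℓ ℓ′ ℓ″ : Level
  m n : ℕ
  P : Pred (Fin n) ℓ
  Q : Pred (Fin n) ℓ′
  A : Pred (Fin n) ℓ″

-- Intervals are given by start and length: [a, a + l) and [b, b + k).
Intersecting : ℕ → ℕ → ℕ → ℕ → Set
Intersecting a l b k = a < b + k × b < a + l

Separated : ℕ → ℕ → ℕ → ℕ → Set
Separated a l b k = a + l ≤ b ⊎ b + k ≤ a

separated⇒¬intersecting : ∀ {a l b k} → Separated a l b k → ¬ Intersecting a l b k
separated⇒¬intersecting (inj₁ a+l≤b) (_ , b<a+l) = <⇒≱ b<a+l a+l≤b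
separated⇒¬intersecting (inj₂ b+k≤a) (a<b+k , _) = <⇒≱ a<b+k b+k≤a

¬intersecting⇒separated : ∀ {a l b k} → ¬ Intersecting a l b k → Separated a l b k
¬intersecting⇒separated {a} {l} {b} {k} ¬meet with a <? b + k | b <? a + l
... | no  a≮b+k | _         = inj₂ (≮⇒≥ a≮b+k)
... | yes _     | no  b≮a+l = inj₁ (≮⇒≥ b≮a+l)
... | yes a<b+k | yes b<a+l = ⊥-elim (¬meet (a<b+k , b<a+l))

multiples-<⇒+≤ : ∀ {d a b} → d ∣ a → d ∣ b → a < b → a + d ≤ b
multiples-<⇒+≤ {d} {a} {b} d∣a d∣b a<b = begin
  a + d       ≤⟨ +-monoʳ-≤ a (∣⇒≤ ⦃ >-nonZero (m<n⇒0<n∸m a<b) ⦄ d∣b∸a) ⟩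
  a + (b ∸ a) ≡⟨ m+[n∸m]≡n (<⇒≤ a<b) ⟩
  b           ∎
  where
  open ≤-Reasoning
  d∣b∸a : d ∣ b ∸ a
  d∣b∸a = ∣m+n∣m⇒∣n (subst (d ∣_) (sym (m+[n∸m]≡n (<⇒≤ a<b))) d∣b) d∣a

aligned-intervals-nest : ∀ {a b y z} → b ∣ a → a ∣ y → b ∣ z →
  Intersecting y a z b → y ≤ z × z + b ≤ y + a
aligned-intervals-nest {a} {b} {y} {z} b∣a a∣y b∣z (y<z+b , z<y+a) =
    +-cancelʳ-≤ b y z (multiples-<⇒+≤ b∣y (∣m∣n⇒∣m+n b∣z ∣-refl) y<z+b)
  , multiples-<⇒+≤ b∣z (∣m∣n⇒∣m+n b∣y b∣a) z<y+a
  where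
  b∣y : b ∣ y
  b∣y = ∣-trans b∣a a∣y

DivisibilityChain : (Fin (suc m) → ℕ) → Set
DivisibilityChain {m} Hs = ∀ (k : Fin m) → Hs (suc k) ∣ Hs (inject₁ k)

divisibility-chain-≤⇒∣ : ∀ {Hs : Fin (suc m) → ℕ} → DivisibilityChain Hs →
  ∀ {a b} → a Fin.≤ b → Hs b ∣ Hs a
divisibility-chain-≤⇒∣ step {zero}  {zero}  _ = ∣-refl
divisibility-chain-≤⇒∣ {suc m} step {zero}  {suc b} _ =
  ∣-trans (divisibility-chain-≤⇒∣ (step ∘ suc) {zero} {b} z≤n) (step zero)
divisibility-chain-≤⇒∣ {suc m} step {suc a} {suc b} (s≤s a≤b) =
  divisibility-chain-≤⇒∣ (step ∘ suc) a≤b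

divisibility-chain-<⇒∣ : ∀ {Hs : Fin (suc m) → ℕ} → DivisibilityChain Hs →
  (∀ k → Hs k > 0) → ∀ a b → Hs a < Hs b → Hs a ∣ Hs b
divisibility-chain-<⇒∣ step Hs-pos a b Hsa<Hsb with Fin.≤-total a b
... | inj₁ a≤b =
  ⊥-elim (<⇒≱ Hsa<Hsb (∣⇒≤ ⦃ >-nonZero (Hs-pos a) ⦄ (divisibility-chain-≤⇒∣ step a≤b)))
... | inj₂ b≤a = divisibility-chain-≤⇒∣ step b≤a

sumWhere : {P : Pred (Fin n) ℓ} → Decidable P → (Fin n → ℕ) → ℕ
sumWhere {zero}  P? w = 0
sumWhere {suc n} P? w with P? zero
... | yes _ = w zero + sumWhere (P? ∘ suc) (w ∘ suc)
... | no  _ = sumWhere (P? ∘ suc) (w ∘ suc)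

sumWhere-mono : (P? : Decidable P) (Q? : Decidable Q) (w : Fin n → ℕ) →
  P ⊆ Q → sumWhere P? w ≤ sumWhere Q? w
sumWhere-mono {n = zero}  P? Q? w P⊆Q = z≤n
sumWhere-mono {n = suc n} P? Q? w P⊆Q
  with P? zero | Q? zero | sumWhere-mono (P? ∘ suc) (Q? ∘ suc) (w ∘ suc) P⊆Q
... | yes _  | yes _  | tail-mono = +-monoʳ-≤ (w zero) tail-mono
... | yes P0 | no ¬Q0 | _         = ⊥-elim (¬Q0 (P⊆Q P0))
... | no  _  | yes _  | tail-mono = ≤-trans tail-mono (m≤n+m _ (w zero))
... | no  _  | no  _  | tail-mono = tail-mono

sumWhere-insert : (P? : Decidable P) (Q? : Decidable Q) (w : Fin n → ℕ) →
  P ⊆ Q → ∀ {i} → Q i → ¬ P i → sumWhere P? w + w i ≤ sumWhere Q? w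
sumWhere-insert P? Q? w P⊆Q {zero} Q0 ¬P0 with P? zero | Q? zero
... | yes P0 | _      = ⊥-elim (¬P0 P0)
... | no  _  | no ¬Q0 = ⊥-elim (¬Q0 Q0)
... | no  _  | yes _  = begin
  sumWhere (P? ∘ suc) (w ∘ suc) + w zero ≡⟨ +-comm _ (w zero) ⟩
  w zero + sumWhere (P? ∘ suc) (w ∘ suc) ≤⟨ +-monoʳ-≤ (w zero)
                                              (sumWhere-mono (P? ∘ suc) (Q? ∘ suc) (w ∘ suc) P⊆Q) ⟩
  w zero + sumWhere (Q? ∘ suc) (w ∘ suc) ∎
  where open ≤-Reasoning
sumWhere-insert P? Q? w P⊆Q {suc i} Qi ¬Pi with P? zero | Q? zero
  | sumWhere-insert (P? ∘ suc) (Q? ∘ suc) (w ∘ suc) P⊆Q Qi ¬Pi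
... | yes P0 | no ¬Q0 | _         = ⊥-elim (¬Q0 (P⊆Q P0))
... | yes _  | yes _  | tail-insert = begin
  w zero + sumWhere (P? ∘ suc) (w ∘ suc) + w (suc i)   ≡⟨ +-assoc (w zero) _ _ ⟩
  w zero + (sumWhere (P? ∘ suc) (w ∘ suc) + w (suc i)) ≤⟨ +-monoʳ-≤ (w zero) tail-insert ⟩
  w zero + sumWhere (Q? ∘ suc) (w ∘ suc)               ∎
  where open ≤-Reasoning
... | no  _  | yes _  | tail-insert = ≤-trans tail-insert (m≤n+m _ (w zero))
... | no  _  | no  _  | tail-insert = tail-insert

sumWhere-partition : (P? : Decidable P) (A? : Decidable A) (w : Fin n → ℕ) →
  sumWhere P? w ≡ sumWhere (P? ∩? A?) w + sumWhere (P? ∩? ∁? A?) w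
sumWhere-partition {n = zero}  P? A? w = refl
sumWhere-partition {n = suc n} P? A? w
  with P? zero | A? zero | sumWhere-partition (P? ∘ suc) (A? ∘ suc) (w ∘ suc)
... | yes _ | yes _ | tail-split =
  trans (cong (_+_ (w zero)) tail-split) (sym (+-assoc (w zero) _ _))
... | yes _ | no  _ | tail-split =
  trans (cong (_+_ (w zero)) tail-split)
        (x∙yz≈y∙xz (w zero) (sumWhere ((P? ∘ suc) ∩? (A? ∘ suc)) (w ∘ suc)) _)
... | no  _ | _     | tail-split = tail-split

sumWhere-separated-≤ : (P? : Decidable P) (x w : Fin n → ℕ) {a b : ℕ} →
  (∀ {k} → P k → a ≤ x k × x k + w k ≤ b) →
  (∀ {k k′} → P k → P k′ → k ≢ k′ → Separated (x k) (w k) (x k′) (w k′)) →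
  a ≤ b → sumWhere P? w + a ≤ b
sumWhere-separated-≤ {n = zero}  P? x w within separated a≤b = a≤b
sumWhere-separated-≤ {n = suc n} {P = P} P? x w {a} {b} within separated a≤b with P? zero
... | no _ = sumWhere-separated-≤ (P? ∘ suc) (x ∘ suc) (w ∘ suc) within
  (λ Pk Pk′ k≢k′ → separated Pk Pk′ (k≢k′ ∘ Fin.suc-injective)) a≤b
-- The other intervals lie either left of interval 0, inside [a, x 0], or right of it,
-- inside [x 0 + w 0, b].
... | yes P0 = begin
  w zero + sumWhere T? w′ + a          ≡⟨ cong (λ s → w zero + s + a)
                                              (sumWhere-partition T? Left? w′) ⟩
  w zero + (sumLeft + sumRight) + a    ≡⟨ rearrange (w zero) sumLeft sumRight a ⟩
  sumRight + (sumLeft + a + w zero)    ≤⟨ +-monoʳ-≤ sumRight (+-monoˡ-≤ (w zero) left-bound) ⟩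
  sumRight + (x zero + w zero)         ≤⟨ right-bound ⟩
  b                                    ∎
  where
  open ≤-Reasoning
  T? = P? ∘ suc
  w′ = w ∘ suc
  Left : Pred (Fin n) _
  Left k = x (suc k) + w (suc k) ≤ x zero
  Left? : Decidable Left
  Left? k = x (suc k) + w (suc k) ≤? x zero
  sumLeft = sumWhere (T? ∩? Left?) w′
  sumRight = sumWhere (T? ∩? ∁? Left?) w′

  rearrange : ∀ v l r c → v + (l + r) + c ≡ r + (l + c + v)
  rearrange = solve-∀

  left-bound : sumLeft + a ≤ x zero
  left-bound = sumWhere-separated-≤ (T? ∩? Left?) (x ∘ suc) w′
    (λ (Pk , Lk) → proj₁ (within Pk) , Lk)
    (λ (Pk , _) (Pk′ , _) k≢k′ → separated Pk Pk′ (k≢k′ ∘ Fin.suc-injective))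
    (proj₁ (within P0))

  right-of-0 : ∀ {k} → P (suc k) → ¬ Left k → x zero + w zero ≤ x (suc k)
  right-of-0 Pk ¬Lk with separated P0 Pk (λ ())
  ... | inj₁ after  = after
  ... | inj₂ before = ⊥-elim (¬Lk before)

  right-bound : sumRight + (x zero + w zero) ≤ b
  right-bound = sumWhere-separated-≤ (T? ∩? ∁? Left?) (x ∘ suc) w′
    (λ (Pk , ¬Lk) → right-of-0 Pk ¬Lk , proj₂ (within Pk))
    (λ (Pk , _) (Pk′ , _) k≢k′ → separated Pk Pk′ (k≢k′ ∘ Fin.suc-injective))
    (proj₂ (within P0))

FeasibleNat : (L H : ℕ) (w h x y : Fin n → ℕ) → Set
FeasibleNat L H w h x y =
  (∀ i → x i + w i ≤ L × y i + h i ≤ H) ×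
  (∀ i j → i ≢ j → Intersecting (y i) (h i) (y j) (h j) → Separated (x i) (w i) (x j) (w j))

module Canonicalisation
  (w h y : Fin n → ℕ)
  (h-pos : ∀ i → h i > 0)
  (h-nested : ∀ i j → h j < h i → h j ∣ h i)
  (y-aligned : ∀ i → h i ∣ y i)
  where

  Covers : Fin n → ℕ → Set
  Covers k r = y k ≤ r × r < y k + h k

  Precedes : Fin n → Fin n → Set
  Precedes k i = (h i < h k × Covers k (y i)) ⊎ (h k ≡ h i × y k ≡ y i × k Fin.< i)

  precedes? : ∀ k i → Dec (Precedes k i)
  precedes? k i = ((h i <? h k) ×-dec ((y k ≤? y i) ×-dec (y i <? y k + h k)))
           ⊎-dec ((h k ≟ h i) ×-dec ((y k ≟ y i) ×-dec (k Fin.<? i)))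

  x′ : Fin n → ℕ
  x′ i = sumWhere (λ k → precedes? k i) w

  nested : ∀ {i j} → h j < h i → Intersecting (y i) (h i) (y j) (h j) →
    y i ≤ y j × y j + h j ≤ y i + h i
  nested {i} {j} hj<hi = aligned-intervals-nest (h-nested i j hj<hi) (y-aligned i) (y-aligned j)

  inside⇒covers : ∀ {i j} → y i ≤ y j → y j + h j ≤ y i + h i → Covers i (y j)
  inside⇒covers {i} {j} yi≤yj top = yi≤yj , <-≤-trans (m<m+n (y j) (h-pos j)) top

  covers⇒intersecting : ∀ {k i} → Covers k (y i) → Intersecting (y k) (h k) (y i) (h i)
  covers⇒intersecting {i = i} (yk≤yi , yi<top) =
    ≤-<-trans yk≤yi (m<m+n (y i) (h-pos i)) , yi<top

  same-height⇒same-level : ∀ {i j} → h i ≡ h j → Intersecting (y i) (h i) (y j) (h j) →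
    y i ≡ y j
  same-height⇒same-level {i} {j} hi≡hj meet = ≤-antisym
    (proj₁ (aligned-intervals-nest (∣-reflexive (sym hi≡hj)) (y-aligned i) (y-aligned j) meet))
    (proj₁ (aligned-intervals-nest (∣-reflexive hi≡hj) (y-aligned j) (y-aligned i) (swap meet)))

  Precedes-irrefl : ∀ {i} → ¬ Precedes i i
  Precedes-irrefl (inj₁ (hi<hi , _))    = <-irrefl refl hi<hi
  Precedes-irrefl (inj₂ (_ , _ , i<i)) = Fin.<-irrefl refl i<i

  Precedes-trans : ∀ {k i j} → Precedes k i → Precedes i j → Precedes k j
  Precedes-trans (inj₁ (hi<hk , ck)) (inj₁ (hj<hi , ci)) =
    inj₁ (<-trans hj<hi hi<hk , ≤-trans (proj₁ ck) (proj₁ ci) ,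
          <-≤-trans (proj₂ ci) (proj₂ (nested hi<hk (covers⇒intersecting ck))))
  Precedes-trans {k} (inj₁ (hi<hk , ck)) (inj₂ (hi≡hj , yi≡yj , _)) =
    inj₁ (subst (_< h k) hi≡hj hi<hk , subst (Covers k) yi≡yj ck)
  Precedes-trans {k} {i} {j} (inj₂ (hk≡hi , yk≡yi , _)) (inj₁ (hj<hi , ci)) =
    inj₁ (subst (h j <_) (sym hk≡hi) hj<hi ,
          subst₂ (λ b t → b ≤ y j × y j < b + t) (sym yk≡yi) (sym hk≡hi) ci)
  Precedes-trans (inj₂ (hk≡hi , yk≡yi , k<i)) (inj₂ (hi≡hj , yi≡yj , i<j)) =
    inj₂ (trans hk≡hi hi≡hj , trans yk≡yi yi≡yj , Fin.<-trans k<i i<j)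

  Precedes⇒Covers : ∀ {k i} → Precedes k i → Covers k (y i)
  Precedes⇒Covers (inj₁ (_ , ck)) = ck
  Precedes⇒Covers {k} (inj₂ (_ , yk≡yi , _)) =
    ≤-reflexive yk≡yi , subst (_< y k + h k) yk≡yi (m<m+n (y k) (h-pos k))

  Precedes-connex : ∀ {i j} → i ≢ j → Intersecting (y i) (h i) (y j) (h j) →
    Precedes i j ⊎ Precedes j i
  Precedes-connex {i} {j} i≢j meet with <-cmp (h i) (h j)
  ... | tri< hi<hj _ _ = inj₂ (inj₁ (hi<hj , uncurry inside⇒covers (nested hi<hj (swap meet))))
  ... | tri> _ _ hj<hi = inj₁ (inj₁ (hj<hi , uncurry inside⇒covers (nested hj<hi meet)))
  ... | tri≈ _ hi≡hj _ with Fin.<-cmp i j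
  ...   | tri< i<j _ _ = inj₁ (inj₂ (hi≡hj , same-height⇒same-level hi≡hj meet , i<j))
  ...   | tri≈ _ i≡j _ = ⊥-elim (i≢j i≡j)
  ...   | tri> _ _ j<i = inj₂ (inj₂ (sym hi≡hj , sym (same-height⇒same-level hi≡hj meet) , j<i))

  x′-precedes : ∀ {i j} → Precedes i j → x′ i + w i ≤ x′ j
  x′-precedes {i} {j} i≺j = sumWhere-insert (λ k → precedes? k i) (λ k → precedes? k j) w
    (λ k≺i → Precedes-trans k≺i i≺j) i≺j Precedes-irrefl

  x′-separated : ∀ {i j} → i ≢ j → Intersecting (y i) (h i) (y j) (h j) →
    Separated (x′ i) (w i) (x′ j) (w j)
  x′-separated i≢j meet with Precedes-connex i≢j meet
  ... | inj₁ i≺j = inj₁ (x′-precedes i≺j)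
  ... | inj₂ j≺i = inj₂ (x′-precedes j≺i)

  x′-fits : ∀ {L H x} → FeasibleNat L H w h x y → ∀ i → x′ i + w i ≤ L
  x′-fits {L} {x = x} (fits , separated) i = begin
    x′ i + w i              ≤⟨ sumWhere-insert (λ k → precedes? k i) covers? w Precedes⇒Covers
                                 (≤-refl , m<m+n (y i) (h-pos i)) Precedes-irrefl ⟩
    sumWhere covers? w      ≡⟨ +-identityʳ _ ⟨
    sumWhere covers? w + 0  ≤⟨ sumWhere-separated-≤ covers? x w
                                 (λ {k} _ → z≤n , proj₁ (fits k)) separated-on-row z≤n ⟩
    L                       ∎
    where
    open ≤-Reasoning
    covers? : ∀ k → Dec (Covers k (y i))
    covers? k = (y k ≤? y i) ×-dec (y i <? y k + h k)
    separated-on-row : ∀ {k k′} → Covers k (y i) → Covers k′ (y i) → k ≢ k′ →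
      Separated (x k) (w k) (x k′) (w k′)
    separated-on-row {k} {k′} (yk≤yi , yi<k) (yk′≤yi , yi<k′) k≢k′ =
      separated k k′ k≢k′ (≤-<-trans yk≤yi yi<k′ , ≤-<-trans yk′≤yi yi<k)

  x′-feasible : ∀ {L H x} → FeasibleNat L H w h x y → FeasibleNat L H w h x′ y
  x′-feasible feasible = (λ i → x′-fits feasible i , proj₂ (proj₁ feasible i))
                       , λ i j i≢j → x′-separated i≢j

  x′-canonical : ∀ {i j} → h j < h i → y i ≤ y j → y j + h j ≤ y i + h i →
    x′ i + w i ≤ x′ j
  x′-canonical hj<hi yi≤yj top = x′-precedes (inj₁ (hj<hi , inside⇒covers yi≤yj top))

[+a]-[+b]<[+c]⇔a<c+b : ∀ a b c → + a ℤ.- + b ℤ.< + c ⇔ a < c + b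
[+a]-[+b]<[+c]⇔a<c+b a b c = mk⇔
  (λ lt → ℤ.drop‿+<+
     (subst (ℤ._< + c ℤ.+ + b) (//-rightDividesˡ (+ b) (+ a)) (ℤ.+-monoˡ-< (+ b) lt)))
  (λ lt →
     subst (+ a ℤ.- + b ℤ.<_) (//-rightDividesʳ (+ b) (+ c)) (ℤ.+-monoˡ-< (ℤ.- + b) (+<+ lt)))

Overlap-+⇔ : ∀ (w h x y : Fin n → ℕ) i j →
  Overlap w h (+_ ∘ x) (+_ ∘ y) i j ⇔
  (Intersecting (x i) (w i) (x j) (w j) × Intersecting (y i) (h i) (y j) (h j))
Overlap-+⇔ w h x y i j = mk⇔
  (λ ((xi<xj+wj , xj<xi+wi) , (yi<yj+hj , yj<yi+hi)) →
      (to x-bound xi<xj+wj , ℤ.drop‿+<+ xj<xi+wi) , (to y-bound yi<yj+hj , ℤ.drop‿+<+ yj<yi+hi))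
  (λ ((xi<xj+wj , xj<xi+wi) , (yi<yj+hj , yj<yi+hi)) →
      (from x-bound xi<xj+wj , +<+ xj<xi+wi) , (from y-bound yi<yj+hj , +<+ yj<yi+hi))
  where
  open Equivalence
  x-bound = [+a]-[+b]<[+c]⇔a<c+b (x i) (w j) (x j)
  y-bound = [+a]-[+b]<[+c]⇔a<c+b (y i) (h j) (y j)

Feasible-+⇔ : ∀ {L H} {w h x y : Fin n → ℕ} →
  Feasible L H w h (+_ ∘ x) (+_ ∘ y) ⇔ FeasibleNat L H w h x y
Feasible-+⇔ {w = w} {h} {x} {y} = mk⇔
  (λ (bounds , disjoint) →
      (λ i → let (_ , _ , x-fits , y-fits) = bounds i in
         ℤ.drop‿+≤+ x-fits , ℤ.drop‿+≤+ y-fits) ,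
      (λ i j i≢j meetᵧ → ¬intersecting⇒separated (λ meetₓ →
         disjoint i j i≢j (Equivalence.from (Overlap-+⇔ w h x y i j) (meetₓ , meetᵧ)))))
  (λ (fits , separated) →
      (λ i → +≤+ z≤n , +≤+ z≤n , +≤+ (proj₁ (fits i)) , +≤+ (proj₂ (fits i))) ,
      (λ i j i≢j overlaps →
         let (meetₓ , meetᵧ) = Equivalence.to (Overlap-+⇔ w h x y i j) overlaps in
         separated⇒¬intersecting (separated i j i≢j meetᵧ) meetₓ))

Feasible-resp-≗ : ∀ {L H} {w h : Fin n → ℕ} {x y x′ y′ : Fin n → ℤ} →
  x ≗ x′ → y ≗ y′ → Feasible L H w h x y → Feasible L H w h x′ y′
Feasible-resp-≗ {L = L} {H} {w} {h} {x′ = x′} {y′} x≗x′ y≗y′ (bounds , disjoint) =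
  bounds′ , disjoint′
  where
  bounds′ : ∀ i →
    + 0 ℤ.≤ x′ i × + 0 ℤ.≤ y′ i × x′ i ℤ.+ + w i ℤ.≤ + L × y′ i ℤ.+ + h i ℤ.≤ + H
  bounds′ i rewrite sym (x≗x′ i) | sym (y≗y′ i) = bounds i
  disjoint′ : ∀ i j → i ≢ j → ¬ Overlap w h x′ y′ i j
  disjoint′ i j i≢j overlaps
    rewrite sym (x≗x′ i) | sym (x≗x′ j) | sym (y≗y′ i) | sym (y≗y′ j) = disjoint i j i≢j overlaps

Feasible⇒FeasibleNat : ∀ {L H} {w h : Fin n → ℕ} {x y : Fin n → ℤ} →
  Feasible L H w h x y → FeasibleNat L H w h (∣_∣ ∘ x) (∣_∣ ∘ y)
Feasible⇒FeasibleNat feasible@(bounds , _) = Equivalence.to Feasible-+⇔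
  (Feasible-resp-≗ (λ i → sym (ℤ.0≤i⇒+∣i∣≡i (proj₁ (bounds i))))
                   (λ i → sym (ℤ.0≤i⇒+∣i∣≡i (proj₁ (proj₂ (bounds i))))) feasible)

theorem2 : (H : ℕ) → H > 0 →
    (m : ℕ) (Hs : Fin (suc m) → ℕ) →
    (∀ k → Hs k > 0) →
    (∀ (k : Fin m) → Hs (inject₁ k) > Hs (suc k)) →
    Hs zero ≡ H → Hs (fromℕ m) ≡ 1 →
    (∀ (k : Fin m) → Hs (suc k) ∣ Hs (inject₁ k)) →
    (n : ℕ) (w h : Fin n → ℕ) →
    (∀ i → w i > 0) →
    (∀ i → ∃[ k ] h i ≡ Hs k) →
    (L : ℕ) →
    (∃[ x ] ∃[ y ] (Feasible L H w h x y × HeightDivisible h y)) →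
    ∃[ x ] ∃[ y ] (Feasible L H w h x y × HeightDivisible h y × Canonical w h x y)
theorem2 H _ m Hs Hs-pos _ _ _ chain n w h _ h∈Hs L (x , y , feasible , aligned) =
  +_ ∘ x′ , +_ ∘ ∣_∣ ∘ y ,
  Equivalence.from Feasible-+⇔ (x′-feasible (Feasible⇒FeasibleNat feasible)) , aligned ,
  λ i j hj<hi yi≤yj top → +≤+ (x′-canonical hj<hi (ℤ.drop‿+≤+ yi≤yj) (ℤ.drop‿+≤+ top))
  where
  h-pos : ∀ i → h i > 0
  h-pos i = let (k , hi≡Hsk) = h∈Hs i in subst (_> 0) (sym hi≡Hsk) (Hs-pos k)

  h-nested : ∀ i j → h j < h i → h j ∣ h i
  h-nested i j hj<hi = let (k , hi≡Hsk) = h∈Hs i ; (k′ , hj≡Hsk′) = h∈Hs j in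
    subst₂ _∣_ (sym hj≡Hsk′) (sym hi≡Hsk)
      (divisibility-chain-<⇒∣ chain Hs-pos k′ k (subst₂ _<_ hj≡Hsk′ hi≡Hsk hj<hi))

  open Canonicalisation w h (∣_∣ ∘ y) h-pos h-nested aligned
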